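{- Let $\phi=\frac{1+\sqrt5}{2}$ and let $g:\mathbb{Z}_{\geq 0}\to\{0,1\}$ be defined by $g(0)=1$, $g(1)=0$ and, for $n\ge 2$, $g(n)=1-g(m)$ if there is $m\in\mathbb{Z}_{\geq0}$ with $\lfloor n\phi\rfloor=\lfloor m(\phi+1)\rfloor+1$, and $g(n)=1$ otherwise. Let $h$ be Hofstadter's G-sequence, $h(0)=0$ and $h(n)=n-h(h(n-1))$ for $n\ge1$. Then for every $n\ge 2$, $$g(n)=\begin{cases}1-g(h(n-1)) & \text{if } h(n-2)<h(n-1),\\ 1 & \text{otherwise.}\end{cases}$$ -}

module Defs where

open import Data.Nat using (ℕ; zero; suc; _+_; _*_; _∸_; _^_; _≤_; _<_)
open import Data.Product using (_×_; Σ)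
open import Relation.Binary.PropositionalEquality using (_≡_)
open import Relation.Nullary using (¬_)

-- IsFloorSqrt5 a x k  :⇔  k = ⌊ x · (a + √5) / 2 ⌋   (x, a, k natural numbers),
-- i.e.  k ≤ x(a+√5)/2 < k+1, written without reals:
--   k ≤ x(a+√5)/2    ⇔  2k ∸ a x ≤ x√5          ⇔  (2k ∸ a x)² ≤ 5x²
--   x(a+√5)/2 < k+1  ⇔  a x < 2k+2 ∧ x√5 < 2k+2 ∸ a x
--                    ⇔  a x < 2k+2 ∧ 5x² < (2k+2 ∸ a x)²
IsFloorSqrt5 : ℕ → ℕ → ℕ → Set
IsFloorSqrt5 a x k =
  ((2 * k ∸ a * x) ^ 2 ≤ 5 * x ^ 2) ×
  (a * x < 2 * k + 2) ×
  (5 * x ^ 2 < (2 * k + 2 ∸ a * x) ^ 2)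

FloorNφ : ℕ → ℕ → Set
FloorNφ n k = IsFloorSqrt5 1 n k

FloorMφ+1 : ℕ → ℕ → Set
FloorMφ+1 m k = IsFloorSqrt5 3 m k

Cond : ℕ → ℕ → Set
Cond n m = Σ ℕ λ k → FloorNφ n (suc k) × FloorMφ+1 m k

IsHofstadterG : (ℕ → ℕ) → Set
IsHofstadterG h = (h 0 ≡ 0) × (∀ n → h (suc n) ≡ suc n ∸ h (h n))

IsG : (ℕ → ℕ) → Set
IsG g = (g 0 ≡ 1) × (g 1 ≡ 0) ×
        (∀ n m → 2 ≤ n → Cond n m → g n ≡ 1 ∸ g m) ×
        (∀ n → 2 ≤ n → (∀ m → ¬ Cond n m) → g n ≡ 1)

{-# OPTIONS --safe #-}
-- Write ψ = φ − 1 = 1/φ.  Hofstadter's G is h n = ⌊ψ(n + 1)⌋: the recurrence holds because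
-- ⌊ψ(N + 1)⌋ = N − ⌊ψ(⌊ψN⌋ + 1)⌋, a consequence of 1/ψ = 1 + ψ.  Also ⌊nφ⌋ = n + ⌊ψn⌋ and
-- ⌊m(φ + 1)⌋ = 2m + ⌊ψm⌋.  Let t = h(n − 1) = ⌊ψn⌋.  If h(n − 2) < t then ψ(n − 1) < t < ψn, so
-- ⌊tφ⌋ = n − 1 and m = t satisfies ⌊nφ⌋ = n + t = ⌊m(φ + 1)⌋ + 1.  If h(n − 2) = t then
-- ψt < n − 1 − t < ψ(t + 1), and ⌊m(φ + 1)⌋ jumps over ⌊nφ⌋ − 1 = 2t + (n − 1 − t) between m = t and
-- m = t + 1.  Comparisons with ψ are decided in ℕ by squaring, and are strict because √5 is irrational.
module Submission where

open import Defs
open import Data.Nat using (ℕ; zero; suc; _+_; _*_; _∸_; _^_; _≤_; _<_; s≤s; z<s; s≤s⁻¹; _<?_; _≤?_)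
open import Data.Nat.Properties
open import Data.Nat.Induction using (<-wellFounded; <-rec)
open import Data.Nat.Tactic.RingSolver using (solve)
open import Data.List using (_∷_; [])
open import Data.Product using (_×_; _,_; proj₁; proj₂)
open import Data.Sum using (_⊎_; inj₁; inj₂)
open import Data.Empty using (⊥-elim)
open import Induction.WellFounded using (Acc; acc)
open import Relation.Binary.Definitions using (tri<; tri≈; tri>)
open import Relation.Binary.PropositionalEquality
open import Relation.Nullary using (¬_; yes; no)

private
  variable
    a b c d m n r t x N X Y Z W : ℕ

infix 4 _<√5·_ _>√5·_ _<ψ·_ _>ψ·_

_<√5·_ _>√5·_ : ℕ → ℕ → Set
X <√5· Y = X * X < 5 * (Y * Y)
X >√5· Y = 5 * (Y * Y) < X * X

<√5·-+ : X <√5· Y → Z <√5· W → X + Z <√5· Y + W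
<√5·-+ {X} {Y} {Z} {W} X<√5Y Z<√5W = begin-strict
  (X + Z) * (X + Z)                              ≡⟨ solve (X ∷ Z ∷ []) ⟩
  X * X + 2 * (X * Z) + Z * Z                    <⟨ +-mono-<-≤ (+-mono-<-≤ X<√5Y (*-monoʳ-≤ 2 XZ≤5YW)) (<⇒≤ Z<√5W) ⟩
  5 * (Y * Y) + 2 * (5 * (Y * W)) + 5 * (W * W)  ≡⟨ solve (Y ∷ W ∷ []) ⟩
  5 * ((Y + W) * (Y + W))                        ∎
  where
  open ≤-Reasoning
  XZ≤5YW : X * Z ≤ 5 * (Y * W)
  XZ≤5YW = ≮⇒≥ λ 5YW<XZ → <⇒≱ (*-mono-< 5YW<XZ 5YW<XZ) (begin
    (X * Z) * (X * Z)                  ≡⟨ solve (X ∷ Z ∷ []) ⟩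
    (X * X) * (Z * Z)                  ≤⟨ *-mono-≤ (<⇒≤ X<√5Y) (<⇒≤ Z<√5W) ⟩
    (5 * (Y * Y)) * (5 * (W * W))      ≡⟨ solve (Y ∷ W ∷ []) ⟩
    (5 * (Y * W)) * (5 * (Y * W))      ∎)

>√5·-+ : X >√5· Y → Z >√5· W → X + Z >√5· Y + W
>√5·-+ {X} {Y} {Z} {W} X>√5Y Z>√5W = begin-strict
  5 * ((Y + W) * (Y + W))                        ≡⟨ solve (Y ∷ W ∷ []) ⟩
  5 * (Y * Y) + 2 * (5 * (Y * W)) + 5 * (W * W)  <⟨ +-mono-<-≤ (+-mono-<-≤ X>√5Y (*-monoʳ-≤ 2 5YW≤XZ)) (<⇒≤ Z>√5W) ⟩
  X * X + 2 * (X * Z) + Z * Z                    ≡⟨ solve (X ∷ Z ∷ []) ⟩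
  (X + Z) * (X + Z)                              ∎
  where
  open ≤-Reasoning
  5YW≤XZ : 5 * (Y * W) ≤ X * Z
  5YW≤XZ = ≮⇒≥ λ XZ<5YW → <⇒≱ (*-mono-< XZ<5YW XZ<5YW) (begin
    (5 * (Y * W)) * (5 * (Y * W))      ≡⟨ solve (Y ∷ W ∷ []) ⟩
    (5 * (Y * Y)) * (5 * (W * W))      ≤⟨ *-mono-≤ (<⇒≤ X>√5Y) (<⇒≤ Z>√5W) ⟩
    (X * X) * (Z * Z)                  ≡⟨ solve (X ∷ Z ∷ []) ⟩
    (X * Z) * (X * Z)                  ∎)

-- a <ψ· b encodes a < ψ b, i.e. 2a + b < √5 b (and likewise for >ψ·).
-- Records rather than functions, so that a and b can be inferred from a proof.
record _<ψ·_ (a b : ℕ) : Set where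
  constructor mk<ψ·
  field <√5· : 2 * a + b <√5· b

record _>ψ·_ (a b : ℕ) : Set where
  constructor mk>ψ·
  field >√5· : 2 * a + b >√5· b

[2a+b]+[2c+d]≡2[a+c]+[b+d] : ∀ a b c d → (2 * a + b) + (2 * c + d) ≡ 2 * (a + c) + (b + d)
[2a+b]+[2c+d]≡2[a+c]+[b+d] a b c d = solve (a ∷ b ∷ c ∷ d ∷ [])

<ψ·-+ : a <ψ· b → c <ψ· d → a + c <ψ· b + d
<ψ·-+ {a} {b} {c} {d} (mk<ψ· a<ψb) (mk<ψ· c<ψd) = mk<ψ·
  (subst (_<√5· b + d) ([2a+b]+[2c+d]≡2[a+c]+[b+d] a b c d) (<√5·-+ {2 * a + b} {b} a<ψb c<ψd))

>ψ·-+ : a >ψ· b → c >ψ· d → a + c >ψ· b + d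
>ψ·-+ {a} {b} {c} {d} (mk>ψ· a>ψb) (mk>ψ· c>ψd) = mk>ψ·
  (subst (_>√5· b + d) ([2a+b]+[2c+d]≡2[a+c]+[b+d] a b c d) (>√5·-+ {2 * a + b} {b} a>ψb c>ψd))

0<ψ·1 : 0 <ψ· 1
0<ψ·1 = mk<ψ· (<ᵇ⇒< 1 5 _)

1>ψ·1 : 1 >ψ· 1
1>ψ·1 = mk>ψ· (<ᵇ⇒< 5 9 _)

1<ψ·2 : 1 <ψ· 2
1<ψ·2 = mk<ψ· (<ᵇ⇒< 16 20 _)

b≤a⇒9b²≤[2a+b]² : b ≤ a → 9 * (b * b) ≤ (2 * a + b) * (2 * a + b)
b≤a⇒9b²≤[2a+b]² {b} {a} b≤a = begin
  9 * (b * b)                  ≡⟨ solve (b ∷ []) ⟩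
  (2 * b + b) * (2 * b + b)    ≤⟨ *-mono-≤ 2b+b≤2a+b 2b+b≤2a+b ⟩
  (2 * a + b) * (2 * a + b)    ∎
  where
  open ≤-Reasoning
  2b+b≤2a+b = +-monoˡ-≤ b (*-monoʳ-≤ 2 b≤a)

<ψ·⇒< : a <ψ· b → a < b
<ψ·⇒< {a} {b} (mk<ψ· a<ψb) = ≰⇒> λ b≤a →
  <⇒≱ a<ψb (≤-trans (*-monoˡ-≤ (b * b) (≤ᵇ⇒≤ 5 9 _)) (b≤a⇒9b²≤[2a+b]² b≤a))

<ψ·⇒≯ψ· : a <ψ· b → ¬ (a >ψ· b)
<ψ·⇒≯ψ· (mk<ψ· a<ψb) (mk>ψ· a>ψb) = <-asym a<ψb a>ψb

<ψ·-antimonoˡ : c ≤ a → a <ψ· b → c <ψ· b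
<ψ·-antimonoˡ {b = b} c≤a (mk<ψ· a<ψb) = mk<ψ· (≤-<-trans (*-mono-≤ 2c+b≤2a+b 2c+b≤2a+b) a<ψb)
  where 2c+b≤2a+b = +-monoˡ-≤ b (*-monoʳ-≤ 2 c≤a)

>ψ·-monoˡ : a ≤ c → a >ψ· b → c >ψ· b
>ψ·-monoˡ {b = b} a≤c (mk>ψ· a>ψb) = mk>ψ· (<-≤-trans a>ψb (*-mono-≤ 2a+b≤2c+b 2a+b≤2c+b))
  where 2a+b≤2c+b = +-monoˡ-≤ b (*-monoʳ-≤ 2 a≤c)

-- Since 1/ψ = 1 + ψ:  a < ψ (a + c)  ⇔  a + ψ a < a + c  ⇔  ψ a < c, and likewise with > and =.
ψ-reciprocity : ∀ a c → (2 * a + (a + c)) * (2 * a + (a + c)) + (2 * c + a) * (2 * c + a)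
                      ≡ 5 * ((a + c) * (a + c)) + 5 * (a * a)
ψ-reciprocity a c = solve (a ∷ c ∷ [])

m+o≡n+p⇒m<n⇒p<o : ∀ {m n o p} → m + o ≡ n + p → m < n → p < o
m+o≡n+p⇒m<n⇒p<o {m} {n} {o} {p} m+o≡n+p m<n =
  +-cancelˡ-< n p o (subst (_< n + o) m+o≡n+p (+-monoˡ-< o m<n))

<ψ·-reciprocal : a <ψ· a + c → c >ψ· a
<ψ·-reciprocal {a} {c} (mk<ψ· a<ψa+c) = mk>ψ· (m+o≡n+p⇒m<n⇒p<o (ψ-reciprocity a c) a<ψa+c)

>ψ·-reciprocal : a >ψ· a + c → c <ψ· a
>ψ·-reciprocal {a} {c} (mk>ψ· a>ψa+c) = mk<ψ· (m+o≡n+p⇒m<n⇒p<o (sym (ψ-reciprocity a c)) a>ψa+c)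

-- Descent (a, b) ↦ (b − a, a), by ψ-reciprocity.
ψ-irrational : 0 < b → (2 * a + b) * (2 * a + b) ≢ 5 * (b * b)
ψ-irrational {b} {a} = descent {a} (<-wellFounded b)
  where
  descent : ∀ {a b} → Acc _<_ b → 0 < b → (2 * a + b) * (2 * a + b) ≢ 5 * (b * b)
  descent {zero} {b@(suc _)} _ _ b²≡5b² = <⇒≢ (m<m+n (b * b) z<s) b²≡5b²
  descent {a@(suc _)} {b@(suc _)} (acc rs) _ eq with a <? b
  ... | no a≮b = <⇒≢ (<-≤-trans (*-monoˡ-< (b * b) (<ᵇ⇒< 5 9 _)) (b≤a⇒9b²≤[2a+b]² (≮⇒≥ a≮b))) (sym eq)
  ... | yes a<b with c , refl ← m≤n⇒∃[o]m+o≡n (<⇒≤ a<b) = descent {c} {a} (rs a<b) z<s swapped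
    where
    swapped : (2 * c + a) * (2 * c + a) ≡ 5 * (a * a)
    swapped = +-cancelˡ-≡ (5 * (b * b)) _ _ (begin
      5 * (b * b) + (2 * c + a) * (2 * c + a)                    ≡⟨ cong (_+ (2 * c + a) * (2 * c + a)) eq ⟨
      (2 * a + b) * (2 * a + b) + (2 * c + a) * (2 * c + a)      ≡⟨ ψ-reciprocity a c ⟩
      5 * (b * b) + 5 * (a * a)                                  ∎)
      where open ≡-Reasoning

<ψ·⊎>ψ· : 0 < b → a <ψ· b ⊎ a >ψ· b
<ψ·⊎>ψ· {b} {a} 0<b with <-cmp ((2 * a + b) * (2 * a + b)) (5 * (b * b))
... | tri< a<ψb _ _ = inj₁ (mk<ψ· a<ψb)
... | tri≈ _ a≈ψb _ = ⊥-elim (ψ-irrational {a = a} 0<b a≈ψb)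
... | tri> _ _ a>ψb = inj₂ (mk>ψ· a>ψb)

-- IsFloorψ x r  ⇔  r = ⌊ψ x⌋.  Both bounds are strict (ψ x is irrational), so x = 0 has no floor here.
IsFloorψ : ℕ → ℕ → Set
IsFloorψ x r = r <ψ· x × suc r >ψ· x

IsFloorψ-unique : IsFloorψ x r → IsFloorψ x c → r ≡ c
IsFloorψ-unique ⌊ψx⌋≡r ⌊ψx⌋≡c = ≤-antisym (≤-floor ⌊ψx⌋≡r ⌊ψx⌋≡c) (≤-floor ⌊ψx⌋≡c ⌊ψx⌋≡r)
  where
  ≤-floor : IsFloorψ x r → IsFloorψ x c → r ≤ c
  ≤-floor (r<ψx , _) (_ , c+1>ψx) = ≮⇒≥ λ c<r → <ψ·⇒≯ψ· r<ψx (>ψ·-monoˡ c<r c+1>ψx)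

IsFloorψ-reciprocal : a >ψ· b → a <ψ· suc b → IsFloorψ a (b ∸ a)
IsFloorψ-reciprocal {a} {b} a>ψb a<ψb+1 =
  >ψ·-reciprocal (subst (a >ψ·_) (sym a+δ≡b) a>ψb) ,
  <ψ·-reciprocal (subst (a <ψ·_) (trans (cong suc (sym a+δ≡b)) (sym (+-suc a δ))) a<ψb+1)
  where
  δ = b ∸ a
  a+δ≡b : a + δ ≡ b
  a+δ≡b = m+[n∸m]≡n (s≤s⁻¹ (<ψ·⇒< a<ψb+1))

-- ⌊ψ(N + 1)⌋ is t + 1 or t according as t + 1 < ψ(N + 1) or not; IsFloorψ-reciprocal then identifies u.
IsFloorψ-hofstadter : ∀ {N t u} → IsFloorψ N t → IsFloorψ (suc t) u → IsFloorψ (suc N) (N ∸ u)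
IsFloorψ-hofstadter {N} {t} {u} (t<ψN , t+1>ψN) ⌊ψ[t+1]⌋≡u with <ψ·⊎>ψ· {suc N} {suc t} z<s
... | inj₁ t+1<ψN+1 = subst (IsFloorψ (suc N)) (sym N∸u≡t+1) (t+1<ψN+1 , >ψ·-+ 1>ψ·1 t+1>ψN)
  where
  N∸u≡t+1 : N ∸ u ≡ suc t
  N∸u≡t+1 = trans (cong (N ∸_) (IsFloorψ-unique ⌊ψ[t+1]⌋≡u (IsFloorψ-reciprocal t+1>ψN t+1<ψN+1)))
                  (m∸[m∸n]≡n (s≤s⁻¹ (<ψ·⇒< t+1<ψN+1)))
... | inj₂ t+1>ψN+1 = subst (IsFloorψ (suc N)) (sym N∸u≡t) (<ψ·-+ 0<ψ·1 t<ψN , t+1>ψN+1)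
  where
  N∸u≡t : N ∸ u ≡ t
  N∸u≡t = trans (cong (N ∸_) (IsFloorψ-unique ⌊ψ[t+1]⌋≡u (IsFloorψ-reciprocal t+1>ψN+1 (<ψ·-+ 1<ψ·2 t<ψN))))
                (m∸[m∸n]≡n (<⇒≤ (<ψ·⇒< t<ψN)))

hofstadterG-floorψ : ∀ h → IsHofstadterG h → ∀ n → IsFloorψ (suc n) (h n)
hofstadterG-floorψ h (h0≡0 , h-suc) = <-rec _ floor
  where
  floor : ∀ n → (∀ {m} → m < n → IsFloorψ (suc m) (h m)) → IsFloorψ (suc n) (h n)
  floor zero _ = subst (IsFloorψ 1) (sym h0≡0) (0<ψ·1 , 1>ψ·1)
  floor (suc n) rec =
    subst (IsFloorψ (2 + n)) (sym (h-suc n)) (IsFloorψ-hofstadter ⌊ψ[n+1]⌋ (rec (<ψ·⇒< (proj₁ ⌊ψ[n+1]⌋))))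
    where
    ⌊ψ[n+1]⌋ : IsFloorψ (suc n) (h n)
    ⌊ψ[n+1]⌋ = rec (n<1+n n)

x^2≡x*x : ∀ x → x ^ 2 ≡ x * x
x^2≡x*x x = cong (x *_) (*-identityʳ x)

-- ⌊x (c + φ)⌋ = (c + 1) x + ⌊ψ x⌋, because (1 + 2c + √5)/2 = c + 1 + ψ.
IsFloorψ⇒IsFloorSqrt5 : ∀ c → IsFloorψ x r → IsFloorSqrt5 (1 + 2 * c) x (suc c * x + r)
IsFloorψ⇒IsFloorSqrt5 {x} {r} c (mk<ψ· r<ψx , mk>ψ· r+1>ψx) = lower , ax<2k+2 , upper
  where
  open ≤-Reasoning
  ax = (1 + 2 * c) * x
  k  = suc c * x + r
  2k≡ax+[2r+x] : 2 * (suc c * x + r) ≡ (1 + 2 * c) * x + (2 * r + x)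
  2k≡ax+[2r+x] = solve (c ∷ x ∷ r ∷ [])
  2k+2≡ax+[2r+2+x] : 2 * (suc c * x + r) + 2 ≡ (1 + 2 * c) * x + (2 * suc r + x)
  2k+2≡ax+[2r+2+x] = solve (c ∷ x ∷ r ∷ [])
  2k∸ax≡2r+x : 2 * k ∸ ax ≡ 2 * r + x
  2k∸ax≡2r+x = trans (cong (_∸ ax) 2k≡ax+[2r+x]) (m+n∸m≡n ax (2 * r + x))
  2k+2∸ax≡2r+2+x : 2 * k + 2 ∸ ax ≡ 2 * suc r + x
  2k+2∸ax≡2r+2+x = trans (cong (_∸ ax) 2k+2≡ax+[2r+2+x]) (m+n∸m≡n ax (2 * suc r + x))
  lower : (2 * k ∸ ax) ^ 2 ≤ 5 * x ^ 2
  lower = begin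
    (2 * k ∸ ax) ^ 2             ≡⟨ trans (cong (_^ 2) 2k∸ax≡2r+x) (x^2≡x*x (2 * r + x)) ⟩
    (2 * r + x) * (2 * r + x)    ≤⟨ <⇒≤ r<ψx ⟩
    5 * (x * x)                  ≡⟨ cong (5 *_) (x^2≡x*x x) ⟨
    5 * x ^ 2                    ∎
  ax<2k+2 : ax < 2 * k + 2
  ax<2k+2 = subst (ax <_) (sym 2k+2≡ax+[2r+2+x]) (m<m+n ax z<s)
  upper : 5 * x ^ 2 < (2 * k + 2 ∸ ax) ^ 2
  upper = begin-strict
    5 * x ^ 2                            ≡⟨ cong (5 *_) (x^2≡x*x x) ⟩
    5 * (x * x)                          <⟨ r+1>ψx ⟩
    (2 * suc r + x) * (2 * suc r + x)    ≡⟨ trans (cong (_^ 2) 2k+2∸ax≡2r+2+x) (x^2≡x*x (2 * suc r + x)) ⟨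
    (2 * k + 2 ∸ ax) ^ 2                 ∎

IsFloorψ⇒FloorNφ : IsFloorψ x r → FloorNφ x (x + r)
IsFloorψ⇒FloorNφ {x} {r} ⌊ψx⌋≡r =
  subst (FloorNφ x) (cong (_+ r) (*-identityˡ x)) (IsFloorψ⇒IsFloorSqrt5 0 ⌊ψx⌋≡r)

IsFloorψ⇒FloorMφ+1 : IsFloorψ x r → FloorMφ+1 x (2 * x + r)
IsFloorψ⇒FloorMφ+1 = IsFloorψ⇒IsFloorSqrt5 1

IsFloorSqrt5-unique : ∀ a x k k′ → IsFloorSqrt5 a x k → IsFloorSqrt5 a x k′ → k ≡ k′
IsFloorSqrt5-unique a x k k′ p q = ≤-antisym (≤-floor k k′ p q) (≤-floor k′ k q p)
  where
  ≤-floor : ∀ k k′ → IsFloorSqrt5 a x k → IsFloorSqrt5 a x k′ → k ≤ k′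
  ≤-floor k k′ (lower , _) (_ , _ , upper′) =
    m<1+n⇒m≤n (*-cancelˡ-< 2 k (suc k′) (subst (2 * k <_) 2k′+2≡2[k′+1] 2k<2k′+2))
    where
    2k′+2≡2[k′+1] : 2 * k′ + 2 ≡ 2 * suc k′
    2k′+2≡2[k′+1] = solve (k′ ∷ [])
    2k∸ax<2k′+2∸ax : 2 * k ∸ a * x < 2 * k′ + 2 ∸ a * x
    2k∸ax<2k′+2∸ax = ≰⇒> λ ≥ → <⇒≱ (≤-<-trans lower upper′) (^-monoˡ-≤ 2 ≥)
    2k<2k′+2 : 2 * k < 2 * k′ + 2
    2k<2k′+2 = ≰⇒> λ ≥ → <⇒≱ 2k∸ax<2k′+2∸ax (∸-monoˡ-≤ (a * x) ≥)

-- ⌊m(φ + 1)⌋ = 2m + ⌊ψm⌋ is below 2t + d for m ≤ t and above it for m > t.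
FloorMφ+1-skips : d >ψ· t → d <ψ· suc t → ∀ m → ¬ FloorMφ+1 m (2 * t + d)
FloorMφ+1-skips {d} {t} (mk>ψ· d>ψt) (mk<ψ· d<ψt+1) m (lower , _ , upper) with m ≤? t
... | yes m≤t = <-irrefl refl (begin-strict
  5 * (t * t)                  <⟨ d>ψt ⟩
  (2 * d + t) * (2 * d + t)    ≤⟨ *-mono-≤ 2d+t≤L 2d+t≤L ⟩
  L * L                        ≡⟨ x^2≡x*x L ⟨
  L ^ 2                        ≤⟨ lower ⟩
  5 * m ^ 2                    ≡⟨ cong (5 *_) (x^2≡x*x m) ⟩
  5 * (m * m)                  ≤⟨ *-monoʳ-≤ 5 (*-mono-≤ m≤t m≤t) ⟩
  5 * (t * t)                  ∎)
  where
  open ≤-Reasoning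
  L = 2 * (2 * t + d) ∸ 3 * m
  2d+t≤L : 2 * d + t ≤ L
  2d+t≤L = m+n≤o⇒m≤o∸n (2 * d + t) (begin
    2 * d + t + 3 * m    ≤⟨ +-monoʳ-≤ (2 * d + t) (*-monoʳ-≤ 3 m≤t) ⟩
    2 * d + t + 3 * t    ≡⟨ solve (d ∷ t ∷ []) ⟩
    2 * (2 * t + d)      ∎)
... | no m≰t = <-irrefl refl (begin-strict
  5 * (suc t * suc t)                  ≤⟨ *-monoʳ-≤ 5 (*-mono-≤ t<m t<m) ⟩
  5 * (m * m)                          ≡⟨ cong (5 *_) (x^2≡x*x m) ⟨
  5 * m ^ 2                            <⟨ upper ⟩
  U ^ 2                                ≡⟨ x^2≡x*x U ⟩
  U * U                                ≤⟨ *-mono-≤ U≤2d+t+1 U≤2d+t+1 ⟩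
  (2 * d + suc t) * (2 * d + suc t)    <⟨ d<ψt+1 ⟩
  5 * (suc t * suc t)                  ∎)
  where
  open ≤-Reasoning
  t<m = ≰⇒> m≰t
  U = 2 * (2 * t + d) + 2 ∸ 3 * m
  U≤2d+t+1 : U ≤ 2 * d + suc t
  U≤2d+t+1 = m≤n+o⇒m∸n≤o _ (3 * m) (begin
    2 * (2 * t + d) + 2            ≤⟨ m≤m+n _ 2 ⟩
    2 * (2 * t + d) + 2 + 2        ≡⟨ solve (t ∷ d ∷ []) ⟩
    3 * suc t + (2 * d + suc t)    ≤⟨ +-monoˡ-≤ (2 * d + suc t) (*-monoʳ-≤ 3 t<m) ⟩
    3 * m + (2 * d + suc t)        ∎)

2*m+[n∸m]≡n+m : m ≤ n → 2 * m + (n ∸ m) ≡ n + m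
2*m+[n∸m]≡n+m {m} {n} m≤n = begin
  2 * m + (n ∸ m)      ≡⟨ cong (_+ (n ∸ m)) (solve (m ∷ [])) ⟩
  m + m + (n ∸ m)      ≡⟨ +-assoc m m (n ∸ m) ⟩
  m + (m + (n ∸ m))    ≡⟨ cong (m +_) (m+[n∸m]≡n m≤n) ⟩
  m + n                ≡⟨ +-comm m n ⟩
  n + m                ∎
  where open ≡-Reasoning

floorψ-rise⇒Cond : IsFloorψ (suc N) t → t >ψ· N → Cond (suc N) t
floorψ-rise⇒Cond {N} {t} ⌊ψ[N+1]⌋≡t@(t<ψN+1 , _) t>ψN =
  N + t , IsFloorψ⇒FloorNφ ⌊ψ[N+1]⌋≡t ,
  subst (FloorMφ+1 t) (2*m+[n∸m]≡n+m (s≤s⁻¹ (<ψ·⇒< t<ψN+1)))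
    (IsFloorψ⇒FloorMφ+1 (IsFloorψ-reciprocal t>ψN t<ψN+1))

floorψ-flat⇒¬Cond : IsFloorψ (suc N) t → t <ψ· N → ∀ m → ¬ Cond (suc N) m
floorψ-flat⇒¬Cond {N} {t} ⌊ψ[N+1]⌋≡t@(_ , t+1>ψN+1) t<ψN m (k , ⌊[N+1]φ⌋≡k+1 , ⌊m[φ+1]⌋≡k) =
  FloorMφ+1-skips δ>ψt δ<ψt+1 m (subst (FloorMφ+1 m) k≡2t+δ ⌊m[φ+1]⌋≡k)
  where
  t≤N = <⇒≤ (<ψ·⇒< t<ψN)
  δ = N ∸ t
  t+δ≡N : t + δ ≡ N
  t+δ≡N = m+[n∸m]≡n t≤N
  δ>ψt : δ >ψ· t
  δ>ψt = <ψ·-reciprocal (subst (t <ψ·_) (sym t+δ≡N) t<ψN)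
  δ<ψt+1 : δ <ψ· suc t
  δ<ψt+1 = >ψ·-reciprocal (subst (suc t >ψ·_) (cong suc (sym t+δ≡N)) t+1>ψN+1)
  k≡2t+δ : k ≡ 2 * t + δ
  k≡2t+δ = trans (suc-injective (IsFloorSqrt5-unique 1 (suc N) (suc k) (suc N + t) ⌊[N+1]φ⌋≡k+1
                                   (IsFloorψ⇒FloorNφ ⌊ψ[N+1]⌋≡t)))
                 (sym (2*m+[n∸m]≡n+m t≤N))

corollary4p6 : (g h : ℕ → ℕ) → IsG g → IsHofstadterG h →
    ∀ n → 2 ≤ n →
      (h (n ∸ 2) < h (n ∸ 1) → g n ≡ 1 ∸ g (h (n ∸ 1))) × (¬ (h (n ∸ 2) < h (n ∸ 1)) → g n ≡ 1)
corollary4p6 g h _ _ zero ()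
corollary4p6 g h _ _ (suc zero) (s≤s ())
corollary4p6 g h (_ , _ , g-cond , g-no-cond) hofstadter (suc (suc i)) 2≤n = rise , no-rise
  where
  ⌊ψ[i+1]⌋ : IsFloorψ (suc i) (h i)
  ⌊ψ[i+1]⌋ = hofstadterG-floorψ h hofstadter i
  ⌊ψ[i+2]⌋ : IsFloorψ (2 + i) (h (suc i))
  ⌊ψ[i+2]⌋ = hofstadterG-floorψ h hofstadter (suc i)
  rise : h i < h (suc i) → g (2 + i) ≡ 1 ∸ g (h (suc i))
  rise hi<hi+1 = g-cond _ _ 2≤n (floorψ-rise⇒Cond ⌊ψ[i+2]⌋ (>ψ·-monoˡ hi<hi+1 (proj₂ ⌊ψ[i+1]⌋)))
  no-rise : ¬ (h i < h (suc i)) → g (2 + i) ≡ 1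
  no-rise hi≮hi+1 = g-no-cond _ 2≤n (floorψ-flat⇒¬Cond ⌊ψ[i+2]⌋ (<ψ·-antimonoˡ (≮⇒≥ hi≮hi+1) (proj₁ ⌊ψ[i+1]⌋)))
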